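{- Let $p$ be an odd prime and $s$ an integer with $s^2<4p$. Write $s^2-4p=t^2D$ with $t$ a positive integer and $D$ a fundamental discriminant of an imaginary quadratic field, and let $a=\mathrm{ord}_2(t)$. Suppose $s\equiv p+1\pmod 8$. Then: if $p\equiv1\pmod8$ and $D$ is odd, then $a>2$; if $p\equiv5\pmod8$ and $D$ is odd, then $a=2$; if $p\equiv5\pmod 8$ and $D$ is even, then $a<2$. -}

module Defs where

open import Data.Nat as ℕ using (ℕ)
import Data.Nat.Divisibility as ℕD
open import Data.Integer using (ℤ; +_; _*_; _<_; ∣_∣)
open import Data.Integer.DivMod using (_%_)
open import Data.Product using (_×_; Σ)
open import Data.Sum using (_⊎_)
open import Relation.Binary.PropositionalEquality using (_≡_)
open import Relation.Nullary using (¬_)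

SquareFree : ℤ → Set
SquareFree m = ∀ (n : ℕ) → (n ℕ.* n) ℕD.∣ ∣ m ∣ → n ≡ 1

ImagFundDisc : ℤ → Set
ImagFundDisc D =
  (D < + 0) ×
  (((D % + 4 ≡ 1) × SquareFree D)
   ⊎ Σ ℤ (λ m → (D ≡ + 4 * m) × ((m % + 4 ≡ 2) ⊎ (m % + 4 ≡ 3)) × SquareFree m))

Ord2 : ℕ → ℕ → Set
Ord2 t a = (2 ℕ.^ a) ℕD.∣ t × ¬ ((2 ℕ.^ ℕ.suc a) ℕD.∣ t)

module Submission where

-- Write p = c + 8j with c ∈ {1, 5} and s = p + 1 + 8k.  Expanding,
--   s² − 4p = 2⁵ · (2(j+k)² + k)                 if c = 1,
--   s² − 4p = 2⁴ · (1 + 2(2(j+k)² + 2j + 3k))    if c = 5,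
-- so the 2-adic valuation of s² − 4p is at least 5, resp. exactly 4.  On the
-- other side t²D has valuation 2a + ord₂ D, where ord₂ D = 0 for odd D and
-- ord₂ D ∈ {2, 3} (in particular ≥ 2) for an even fundamental discriminant.
-- Comparing valuations gives 2a ≥ 5, 2a = 4 and 2a + ord₂ D = 4 respectively.

open import Defs
open import Data.Nat as ℕ using (ℕ; _%_; zero; suc; s≤s)
open import Data.Nat.Primality using (Prime; euclidsLemma; prime?)
open import Data.Integer as ℤ using (ℤ; +_; _*_; _+_; _-_; _^_; ∣_∣)
open import Data.Integer.Divisibility as ℤD using ()
open import Data.Product using (_×_; _,_; Σ; ∃₂; proj₁; proj₂)
open import Data.Sum using (inj₁; inj₂)
open import Data.Empty using (⊥-elim)
open import Relation.Binary.PropositionalEquality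
  using (_≡_; refl; sym; trans; cong; cong₂; subst; module ≡-Reasoning)
open import Relation.Nullary using (¬_)
open import Relation.Nullary.Decidable using (from-yes)
import Data.Nat.Properties as ℕP
import Data.Nat.Divisibility as ℕD
import Data.Nat.DivMod as ℕDM
import Data.Integer.Properties as ℤP
import Data.Integer.DivMod as ℤDM
import Data.Integer.Divisibility.Signed as Signed
open import Data.Integer.Tactic.RingSolver using (solve-∀)

Odd : ℤ → Set
Odd x = ¬ (+ 2 ℤD.∣ x)

even-2* : ∀ w → + 2 ℤD.∣ (+ 2 * w)
even-2* w = Signed.∣⇒∣ᵤ (Signed.divides w (ℤP.*-comm (+ 2) w))

-- Numbers of the form 1 + 2w are odd: otherwise 2 would divide their difference 1.
odd-1+2* : ∀ w → Odd (+ 1 + + 2 * w)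
odd-1+2* w 2∣1+2w = 2∤1 (Signed.∣⇒∣ᵤ {+ 2} {+ 1} 2∣1)
  where
  2∤1 : ¬ (2 ℕD.∣ 1)
  2∤1 d with ℕD.∣1⇒≡1 d
  ... | ()
  2∣1 : + 2 Signed.∣ + 1
  2∣1 = Signed.∣m+n∣n⇒∣m {+ 2} {+ 1} {+ 2 * w}
          (Signed.∣ᵤ⇒∣ {+ 2} {+ 1 + + 2 * w} 2∣1+2w) (Signed.∣ᵤ⇒∣ {+ 2} {+ 2 * w} (even-2* w))

odd-* : ∀ x y → Odd x → Odd y → Odd (x * y)
odd-* x y odd-x odd-y 2∣xy
  with euclidsLemma ∣ x ∣ ∣ y ∣ (from-yes (prime? 2)) (subst (2 ℕD.∣_) (ℤP.abs-* x y) 2∣xy)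
... | inj₁ 2∣x = odd-x 2∣x
... | inj₂ 2∣y = odd-y 2∣y

record Ord2ℤ (x : ℤ) (e : ℕ) : Set where
  constructor ord2ℤ
  field
    oddPart       : ℤ
    oddPart-odd   : Odd oddPart
    factorisation : x ≡ (+ 2) ^ e * oddPart

ord2ℤ-bound : ∀ {x e} → Ord2ℤ x e → ∀ b y → x ≡ (+ 2) ^ b * y → b ℕ.≤ e
ord2ℤ-bound _ zero y _ = ℕ.z≤n
ord2ℤ-bound {e = zero} (ord2ℤ u odd-u x≡u) (suc b) y x≡2v =
  ⊥-elim (odd-u (subst (+ 2 ℤD.∣_) (sym u≡2v) (even-2* ((+ 2) ^ b * y))))
  where
  u≡2v : u ≡ + 2 * ((+ 2) ^ b * y)
  u≡2v = trans (sym (ℤP.*-identityˡ u)) (trans (sym x≡u) (trans x≡2v (ℤP.*-assoc (+ 2) ((+ 2) ^ b) y)))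
ord2ℤ-bound {x} {suc e} (ord2ℤ u odd-u x≡2w) (suc b) y x≡2v =
  s≤s (ord2ℤ-bound (ord2ℤ u odd-u refl) b y w≡v)
  where
  w≡v : (+ 2) ^ e * u ≡ (+ 2) ^ b * y
  w≡v = ℤP.*-cancelˡ-≡ (+ 2) _ _ (begin
    + 2 * ((+ 2) ^ e * u)   ≡⟨ ℤP.*-assoc (+ 2) ((+ 2) ^ e) u ⟨
    (+ 2) ^ suc e * u       ≡⟨ sym x≡2w ⟩
    x                       ≡⟨ x≡2v ⟩
    (+ 2) ^ suc b * y       ≡⟨ ℤP.*-assoc (+ 2) ((+ 2) ^ b) y ⟩
    + 2 * ((+ 2) ^ b * y)   ∎)
    where open ≡-Reasoning

ord2ℤ-unique : ∀ {x e f} → Ord2ℤ x e → Ord2ℤ x f → e ≡ f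
ord2ℤ-unique ord-e@(ord2ℤ u _ x≡u) ord-f@(ord2ℤ v _ x≡v) =
  ℕP.≤-antisym (ord2ℤ-bound ord-f _ u x≡u) (ord2ℤ-bound ord-e _ v x≡v)

ord2ℤ-* : ∀ {x y e f} → Ord2ℤ x e → Ord2ℤ y f → Ord2ℤ (x * y) (e ℕ.+ f)
ord2ℤ-* {x} {y} {e} {f} (ord2ℤ u odd-u x≡u) (ord2ℤ v odd-v y≡v) = ord2ℤ (u * v) (odd-* u v odd-u odd-v) xy≡
  where
  open ≡-Reasoning
  xy≡ : x * y ≡ (+ 2) ^ (e ℕ.+ f) * (u * v)
  xy≡ = begin
    x * y                             ≡⟨ cong₂ _*_ x≡u y≡v ⟩
    ((+ 2) ^ e * u) * ((+ 2) ^ f * v) ≡⟨ rearrange ((+ 2) ^ e) ((+ 2) ^ f) u v ⟩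
    ((+ 2) ^ e * (+ 2) ^ f) * (u * v) ≡⟨ cong (_* (u * v)) (ℤP.^-distribˡ-+-* (+ 2) e f) ⟨
    (+ 2) ^ (e ℕ.+ f) * (u * v)       ∎
    where
    rearrange : ∀ a b c d → (a * c) * (b * d) ≡ (a * b) * (c * d)
    rearrange = solve-∀

ord2ℤ-*odd : ∀ {x y e} → Ord2ℤ x e → Odd y → Ord2ℤ (x * y) e
ord2ℤ-*odd {y = y} {e = e} (ord2ℤ u odd-u x≡u) odd-y =
  ord2ℤ (u * y) (odd-* u y odd-u odd-y) (trans (cong (_* y) x≡u) (ℤP.*-assoc ((+ 2) ^ e) u y))

pos-^ : ∀ m n → + (m ℕ.^ n) ≡ (+ m) ^ n
pos-^ m zero    = refl
pos-^ m (suc n) = trans (ℤP.pos-* m (m ℕ.^ n)) (cong (+ m *_) (pos-^ m n))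

ord2-square : ∀ t a → Ord2 t a → Ord2ℤ (+ (t ℕ.* t)) (2 ℕ.* a)
ord2-square t a (ℕD.divides q t≡q2ᵃ , 2ᵃ⁺¹∤t) =
  subst (Ord2ℤ (+ (t ℕ.* t))) (cong (a ℕ.+_) (sym (ℕP.+-identityʳ a)))
    (subst (λ z → Ord2ℤ z (a ℕ.+ a)) (sym (ℤP.pos-* t t)) (ord2ℤ-* {e = a} {f = a} ord-t ord-t))
  where
  odd-q : Odd (+ q)
  odd-q (ℕD.divides r q≡2r) = 2ᵃ⁺¹∤t (ℕD.divides r (begin
    t                  ≡⟨ t≡q2ᵃ ⟩
    q ℕ.* 2 ℕ.^ a      ≡⟨ cong (ℕ._* 2 ℕ.^ a) q≡2r ⟩
    r ℕ.* 2 ℕ.* 2 ℕ.^ a ≡⟨ ℕP.*-assoc r 2 (2 ℕ.^ a) ⟩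
    r ℕ.* 2 ℕ.^ suc a  ∎))
    where open ≡-Reasoning
  ord-t : Ord2ℤ (+ t) a
  ord-t = ord2ℤ (+ q) odd-q (begin
    + t                   ≡⟨ cong +_ (trans t≡q2ᵃ (ℕP.*-comm q (2 ℕ.^ a))) ⟩
    + (2 ℕ.^ a ℕ.* q)     ≡⟨ ℤP.pos-* (2 ℕ.^ a) q ⟩
    + (2 ℕ.^ a) * + q     ≡⟨ cong (_* + q) (pos-^ 2 a) ⟩
    (+ 2) ^ a * + q       ∎)
    where open ≡-Reasoning

residueDisc : ℕ → ℤ → ℤ → ℤ
residueDisc c j k = s * s - + 4 * p
  where
  p s : ℤ
  p = + c + + 8 * j
  s = p + + 1 + + 8 * k

disc-residue-form : ∀ (p : ℕ) (s : ℤ) {c} → p % 8 ≡ c → + 8 ℤD.∣ (s - + (p ℕ.+ 1)) →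
  ∃₂ λ j k → s * s - + (4 ℕ.* p) ≡ residueDisc c j k
disc-residue-form p s {c} p%8≡c 8∣s-p-1 = + (p ℕ./ 8) , k , (begin
    s * s - + (4 ℕ.* p)   ≡⟨ cong₂ (λ a b → a * a - b) s≡ (ℤP.pos-* 4 p) ⟩
    S * S - + 4 * + p     ≡⟨ cong (λ P → (P + + 1 + + 8 * k) * (P + + 1 + + 8 * k) - + 4 * P) p≡ ⟩
    residueDisc c (+ (p ℕ./ 8)) k ∎)
  where
  open ≡-Reasoning
  8∣ˢs-p-1 : + 8 Signed.∣ (s - + (p ℕ.+ 1))
  8∣ˢs-p-1 = Signed.∣ᵤ⇒∣ {+ 8} {s - + (p ℕ.+ 1)} 8∣s-p-1
  k : ℤ
  k = Signed._∣_.quotient 8∣ˢs-p-1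
  S : ℤ
  S = + p + + 1 + + 8 * k
  s≡ : s ≡ S
  s≡ = begin
    s                                 ≡⟨ sub-add s (+ (p ℕ.+ 1)) ⟩
    (s - + (p ℕ.+ 1)) + + (p ℕ.+ 1)   ≡⟨ cong₂ _+_ (Signed._∣_.equality 8∣ˢs-p-1) (ℤP.pos-+ p 1) ⟩
    k * + 8 + (+ p + + 1)             ≡⟨ reorder k (+ p) ⟩
    S                                 ∎
    where
    sub-add : ∀ a b → a ≡ (a - b) + b
    sub-add = solve-∀
    reorder : ∀ k P → k * + 8 + (P + + 1) ≡ P + + 1 + + 8 * k
    reorder = solve-∀
  p≡ : + p ≡ + c + + 8 * + (p ℕ./ 8)
  p≡ = begin
    + p                                  ≡⟨ cong +_ (ℕDM.m≡m%n+[m/n]*n p 8) ⟩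
    + (p % 8 ℕ.+ p ℕ./ 8 ℕ.* 8)          ≡⟨ cong (λ r → + (r ℕ.+ p ℕ./ 8 ℕ.* 8)) p%8≡c ⟩
    + (c ℕ.+ p ℕ./ 8 ℕ.* 8)              ≡⟨ ℤP.pos-+ c _ ⟩
    + c + + (p ℕ./ 8 ℕ.* 8)              ≡⟨ cong (λ r → + c + + r) (ℕP.*-comm (p ℕ./ 8) 8) ⟩
    + c + + (8 ℕ.* (p ℕ./ 8))            ≡⟨ cong (λ r → + c + r) (ℤP.pos-* 8 (p ℕ./ 8)) ⟩
    + c + + 8 * + (p ℕ./ 8)              ∎

residueDisc-1 : ∀ j k → residueDisc 1 j k ≡ (+ 2) ^ 5 * (+ 2 * ((j + k) * (j + k)) + k)
residueDisc-1 = expand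
  where
  expand : ∀ j k → let p = + 1 + + 8 * j; s = p + + 1 + + 8 * k in
    s * s - + 4 * p ≡ + 32 * (+ 2 * ((j + k) * (j + k)) + k)
  expand = solve-∀

residueDisc-5 : ∀ j k →
  residueDisc 5 j k ≡ (+ 2) ^ 4 * (+ 1 + + 2 * (+ 2 * ((j + k) * (j + k)) + + 2 * j + + 3 * k))
residueDisc-5 = expand
  where
  expand : ∀ j k → let p = + 5 + + 8 * j; s = p + + 1 + + 8 * k in
    s * s - + 4 * p ≡ + 16 * (+ 1 + + 2 * (+ 2 * ((j + k) * (j + k)) + + 2 * j + + 3 * k))
  expand = solve-∀

disc-1mod8 : ∀ (p : ℕ) (s : ℤ) → p % 8 ≡ 1 → + 8 ℤD.∣ (s - + (p ℕ.+ 1)) →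
  Σ ℤ λ X → s * s - + (4 ℕ.* p) ≡ (+ 2) ^ 5 * X
disc-1mod8 p s p%8≡1 8∣s-p-1 with disc-residue-form p s p%8≡1 8∣s-p-1
... | j , k , disc≡ = _ , trans disc≡ (residueDisc-1 j k)

disc-5mod8 : ∀ (p : ℕ) (s : ℤ) → p % 8 ≡ 5 → + 8 ℤD.∣ (s - + (p ℕ.+ 1)) →
  Ord2ℤ (s * s - + (4 ℕ.* p)) 4
disc-5mod8 p s p%8≡5 8∣s-p-1 with disc-residue-form p s p%8≡5 8∣s-p-1
... | j , k , disc≡ =
  ord2ℤ _ (odd-1+2* (+ 2 * ((j + k) * (j + k)) + + 2 * j + + 3 * k)) (trans disc≡ (residueDisc-5 j k))

mod4-form : ∀ x {r} → x ℤ.% + 4 ≡ r → x ≡ + r + + 4 * (x ℤ./ + 4)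
mod4-form x {r} x%4≡r = begin
  x                              ≡⟨ ℤDM.a≡a%n+[a/n]*n x (+ 4) ⟩
  + (x ℤ.% + 4) + x ℤ./ + 4 * + 4 ≡⟨ cong₂ (λ a b → + a + b) x%4≡r (ℤP.*-comm (x ℤ./ + 4) (+ 4)) ⟩
  + r + + 4 * (x ℤ./ + 4)        ∎
  where open ≡-Reasoning

-- An even fundamental discriminant D = 4m has m ≡ 2 or 3 (mod 4), hence
-- ord₂ D = 3 or 2; in either case it is at least 2.
fundDisc-even-ord2 : ∀ {D} → ImagFundDisc D → + 2 ℤD.∣ D → Σ ℕ λ e → 2 ℕ.≤ e × Ord2ℤ D e
fundDisc-even-ord2 {D} (_ , inj₁ (D%4≡1 , _)) 2∣D =
  ⊥-elim (odd-1+2* (+ 2 * Q) (subst (+ 2 ℤD.∣_) D≡odd 2∣D))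
  where
  Q = D ℤ./ + 4
  D≡odd : D ≡ + 1 + + 2 * (+ 2 * Q)
  D≡odd = trans (mod4-form D D%4≡1) (regroup Q)
    where
    regroup : ∀ Q → + 1 + + 4 * Q ≡ + 1 + + 2 * (+ 2 * Q)
    regroup = solve-∀
fundDisc-even-ord2 {D} (_ , inj₂ (m , D≡4m , inj₁ m%4≡2 , _)) _ =
  3 , ℕ.s≤s (ℕ.s≤s ℕ.z≤n) , ord2ℤ (+ 1 + + 2 * Q) (odd-1+2* Q) D≡8u
  where
  Q = m ℤ./ + 4
  D≡8u : D ≡ + 8 * (+ 1 + + 2 * Q)
  D≡8u = trans D≡4m (trans (cong (+ 4 *_) (mod4-form m m%4≡2)) (regroup Q))
    where
    regroup : ∀ Q → + 4 * (+ 2 + + 4 * Q) ≡ + 8 * (+ 1 + + 2 * Q)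
    regroup = solve-∀
fundDisc-even-ord2 (_ , inj₂ (m , D≡4m , inj₂ m%4≡3 , _)) _ =
  2 , ℕP.≤-refl , ord2ℤ m (subst Odd (sym m≡odd) (odd-1+2* (+ 1 + + 2 * Q))) D≡4m
  where
  Q = m ℤ./ + 4
  m≡odd : m ≡ + 1 + + 2 * (+ 1 + + 2 * Q)
  m≡odd = trans (mod4-form m m%4≡3) (regroup Q)
    where
    regroup : ∀ Q → + 3 + + 4 * Q ≡ + 1 + + 2 * (+ 1 + + 2 * Q)
    regroup = solve-∀

half-bound : ∀ a e → 2 ℕ.* a ℕ.+ e ≡ 4 → 2 ℕ.≤ e → a ℕ.< 2
half-bound a e 2a+e≡4 2≤e =
  ℕ.s≤s (ℕP.*-cancelˡ-≤ 2 (ℕP.+-cancelʳ-≤ 2 (2 ℕ.* a) 2 (begin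
    2 ℕ.* a ℕ.+ 2 ≤⟨ ℕP.+-monoʳ-≤ (2 ℕ.* a) 2≤e ⟩
    2 ℕ.* a ℕ.+ e ≡⟨ 2a+e≡4 ⟩
    4             ∎)))
  where open ℕP.≤-Reasoning

proposition3p1 : (p : ℕ) → Prime p → p % 2 ≡ 1 →
    (s : ℤ) → s ℤ.* s ℤ.< + (4 ℕ.* p) →
    (t : ℕ) → 0 ℕ.< t → (D : ℤ) → ImagFundDisc D →
    s ℤ.* s ℤ.- + (4 ℕ.* p) ≡ + (t ℕ.* t) ℤ.* D →
    (a : ℕ) → Ord2 t a →
    + 8 ℤD.∣ (s ℤ.- + (p ℕ.+ 1)) →
    ((p % 8 ≡ 1) → ¬ (+ 2 ℤD.∣ D) → 2 ℕ.< a)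
    × ((p % 8 ≡ 5) → ¬ (+ 2 ℤD.∣ D) → a ≡ 2)
    × ((p % 8 ≡ 5) → + 2 ℤD.∣ D → a ℕ.< 2)
proposition3p1 p _ _ s _ t _ D fund-D disc≡t²D a ord-t 8∣s-p-1 = part₁ , part₂ , part₃
  where
  ord-t²D-5 : p % 8 ≡ 5 → Ord2ℤ (+ (t ℕ.* t) * D) 4
  ord-t²D-5 p%8≡5 = subst (λ x → Ord2ℤ x 4) disc≡t²D (disc-5mod8 p s p%8≡5 8∣s-p-1)

  part₁ : p % 8 ≡ 1 → ¬ (+ 2 ℤD.∣ D) → 2 ℕ.< a
  part₁ p%8≡1 odd-D = ℕP.*-cancelˡ-< 2 2 a
    (ord2ℤ-bound (ord2ℤ-*odd (ord2-square t a ord-t) odd-D) 5 X (trans (sym disc≡t²D) disc≡2⁵X))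
    where
    X : ℤ
    X = proj₁ (disc-1mod8 p s p%8≡1 8∣s-p-1)
    disc≡2⁵X : s * s - + (4 ℕ.* p) ≡ (+ 2) ^ 5 * X
    disc≡2⁵X = proj₂ (disc-1mod8 p s p%8≡1 8∣s-p-1)

  part₂ : p % 8 ≡ 5 → ¬ (+ 2 ℤD.∣ D) → a ≡ 2
  part₂ p%8≡5 odd-D =
    ℕP.*-cancelˡ-≡ a 2 2 (ord2ℤ-unique (ord2ℤ-*odd (ord2-square t a ord-t) odd-D) (ord-t²D-5 p%8≡5))

  part₃ : p % 8 ≡ 5 → + 2 ℤD.∣ D → a ℕ.< 2
  part₃ p%8≡5 2∣D with fundDisc-even-ord2 fund-D 2∣D
  ... | e , 2≤e , ord-D =
    half-bound a e (ord2ℤ-unique (ord2ℤ-* (ord2-square t a ord-t) ord-D) (ord-t²D-5 p%8≡5)) 2≤e
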